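{- Let $k\ge0$ be an integer, $s\in[[0,2^k-1]]$, $i\in[[0,\mathrm{last}_{k,s}]]$ and $l\in[[0,l_{k,s,i}]]$. Then $\bigcup_{j=0}^{l}X_{k,s,i,j}=\{\mathrm{rev}_k(t_{k,s,i})+2^{k-l}\cdot x' : x'\in[[0,2^l-1]]\}$ and $\mathrm{rev}_k(t_{k,s,i})<2^{k-l}$.
   Context: $[[a,b]]=\{x\in\mathbb{Z}: a\le x\le b\}$, $n=2^k$. For $x=\sum_{i=0}^{k-1}x_i2^i\in[[0,2^k-1]]$, $\mathrm{rev}_k(x)=\sum_{i=0}^{k-1}x_i2^{k-1-i}$; for a set $S$, $\mathrm{rev}_k S=\{\mathrm{rev}_k(x):x\in S\}$. Define $t_{k,s,0}=s$, $l_{k,s,i}=\max\{l\in[[0,k]] : t_{k,s,i}\bmod 2^l=0\}$, $t_{k,s,i+1}=(t_{k,s,i}+2^{l_{k,s,i}})\bmod n$, $\mathrm{last}_{k,s}=\min\{i\ge0: t_{k,s,i}=0\}$. For $0\le i\le\mathrm{last}_{k,s}$ and $0\le j\le l_{k,s,i}$ let $Y_{k,s,i,j}=[[t_{k,s,i}+\lfloor 2^{j-1}\rfloor,\ t_{k,s,i}+2^j-1]]$ and $X_{k,s,i,j}=\mathrm{rev}_k Y_{k,s,i,j}$. -}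

module Defs where

open import Data.Nat using (ℕ; zero; suc; _+_; _*_; _∸_; _^_; _≤_; _<_)
open import Data.Nat.DivMod using (_/_; _%_)
open import Data.Nat.Properties using (_≟_; m^n≢0)
open import Data.Product using (Σ; _×_; ∃)
open import Relation.Nullary using (yes; no; ¬_)
open import Relation.Binary.PropositionalEquality using (_≡_)

-- rev_k : reverse the k lowest binary digits (x_0 goes to position k-1).
-- On [[0,2^k-1]] this is exactly the paper's rev_k.
rev : ℕ → ℕ → ℕ
rev zero    x = 0
rev (suc k) x = (x % 2) * 2 ^ k + rev k (x / 2)

maxDivExp : ℕ → ℕ → ℕ
maxDivExp zero    t = 0
maxDivExp (suc m) t with _%_ t (2 ^ suc m) {{m^n≢0 2 (suc m)}} ≟ 0
... | yes _ = suc m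
... | no  _ = maxDivExp m t

lval : ℕ → ℕ → ℕ
lval k t = maxDivExp k t

tseq : ℕ → ℕ → ℕ → ℕ
tseq k s zero    = s
tseq k s (suc i) = _%_ (tseq k s i + 2 ^ lval k (tseq k s i)) (2 ^ k) {{m^n≢0 2 k}}

lseq : ℕ → ℕ → ℕ → ℕ
lseq k s i = lval k (tseq k s i)

IsLast : ℕ → ℕ → ℕ → Set
IsLast k s L = (tseq k s L ≡ 0) × (∀ i → i < L → ¬ (tseq k s i ≡ 0))

-- ⌊2^{j-1}⌋  (= 0 for j = 0)
floorHalfPow : ℕ → ℕ
floorHalfPow j = 2 ^ j / 2

Y : ℕ → ℕ → ℕ → ℕ → ℕ → Set
Y k s i j y = (tseq k s i + floorHalfPow j ≤ y) × (y ≤ tseq k s i + 2 ^ j ∸ 1)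

X : ℕ → ℕ → ℕ → ℕ → ℕ → Set
X k s i j x = ∃ λ y → Y k s i j y × (x ≡ rev k y)

-- The blocks [⌊2^{j-1}⌋, 2^j - 1], j ≤ l, tile [0, 2^l), so the Y_j with j ≤ l tile
-- [t, t + 2^l) where t = t_{k,s,i}. Since l ≤ l_{k,s,i}, 2^l divides t = q 2^l, and
-- reversing k bits splits as rev_k(q 2^l + d) = rev_{k-l} q + 2^{k-l} rev_l d for d < 2^l;
-- as rev_l permutes [0, 2^l), the image of [t, t + 2^l) is the stated progression, whose
-- offset rev_k t = rev_{k-l} q is below 2^{k-l}.
module Submission where

open import Defs
open import Data.Nat using (ℕ; _+_; _*_; _∸_; _^_; _≤_; _<_)
open import Data.Product using (_×_; ∃)
open import Function.Bundles using (_⇔_)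
open import Relation.Binary.PropositionalEquality using (_≡_)

open import Data.Nat using (zero; suc; z≤n; s≤s; >-nonZero)
open import Data.Nat.Properties
open import Data.Nat.DivMod
open import Data.Nat.Divisibility using (_∣_; divides; divides-refl; m%n≡0⇒n∣m; ∣-trans)
open import Data.Nat.Solver using (module +-*-Solver)
open import Data.Product using (_,_)
open import Function.Bundles using (Equivalence; mk⇔)
open import Relation.Binary.PropositionalEquality using (refl; sym; trans; cong; cong₂; subst; module ≡-Reasoning)
open import Relation.Nullary using (yes; no)

open +-*-Solver using (solve; _:=_; _:+_; _:*_; con)

^-∣-^ : ∀ b {l m} → l ≤ m → b ^ l ∣ b ^ m
^-∣-^ b {l} {m} l≤m = divides (b ^ (m ∸ l))
  (trans (cong (b ^_) (sym (m∸n+n≡m l≤m))) (^-distribˡ-+-* b (m ∸ l) l))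

maxDivExp-≤ : ∀ m t → maxDivExp m t ≤ m
maxDivExp-≤ zero    t = z≤n
maxDivExp-≤ (suc m) t with _%_ t (2 ^ suc m) {{m^n≢0 2 (suc m)}} ≟ 0
... | yes _ = ≤-refl
... | no  _ = m≤n⇒m≤1+n (maxDivExp-≤ m t)

2^maxDivExp∣ : ∀ m t → 2 ^ maxDivExp m t ∣ t
2^maxDivExp∣ zero    t = divides t (sym (*-identityʳ t))
2^maxDivExp∣ (suc m) t with _%_ t (2 ^ suc m) {{m^n≢0 2 (suc m)}} ≟ 0
... | yes t%2^m≡0 = m%n≡0⇒n∣m t (2 ^ suc m) {{m^n≢0 2 (suc m)}} t%2^m≡0
... | no  _       = 2^maxDivExp∣ m t

rev-< : ∀ k x → rev k x < 2 ^ k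
rev-< zero    x = s≤s z≤n
rev-< (suc k) x = begin-strict
  x % 2 * 2 ^ k + rev k (x / 2)  <⟨ +-mono-≤-< (*-monoˡ-≤ (2 ^ k) (<⇒≤pred (m%n<n x 2))) (rev-< k (x / 2)) ⟩
  1 * 2 ^ k + 2 ^ k              ≡⟨ cong (_+ 2 ^ k) (*-identityˡ (2 ^ k)) ⟩
  2 ^ k + 2 ^ k                  ≡⟨ cong (2 ^ k +_) (+-identityʳ (2 ^ k)) ⟨
  2 ^ suc k                      ∎
  where open ≤-Reasoning

rev-+*2 : ∀ k x c → rev (suc k) (x + c * 2) ≡ x % 2 * 2 ^ k + rev k (x / 2 + c)
rev-+*2 k x c = cong₂ (λ b h → b * 2 ^ k + rev k h)
  ([m+kn]%n≡m%n x c 2)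
  (trans (+-distrib-/-∣ʳ x (divides-refl c)) (cong (x / 2 +_) (m*n/n≡m c 2)))

rev-zero : ∀ k → rev k 0 ≡ 0
rev-zero zero    = refl
rev-zero (suc k) = rev-zero k

rev-*2^+ : ∀ {l k} → l ≤ k → ∀ q x → x < 2 ^ l →
           rev k (q * 2 ^ l + x) ≡ rev (k ∸ l) q + 2 ^ (k ∸ l) * rev l x
rev-*2^+ {zero} _ q (suc x) (s≤s ())
rev-*2^+ {zero} {k} _ q zero _ = begin
  rev k (q * 1 + 0)  ≡⟨ cong (rev k) (trans (+-identityʳ (q * 1)) (*-identityʳ q)) ⟩
  rev k q            ≡⟨ +-identityʳ (rev k q) ⟨
  rev k q + 0        ≡⟨ cong (rev k q +_) (*-zeroʳ (2 ^ k)) ⟨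
  rev k q + 2 ^ k * 0 ∎
  where open ≡-Reasoning
rev-*2^+ {suc l} {suc k} (s≤s l≤k) q x x<2^[1+l] = begin
  rev (suc k) (q * 2 ^ suc l + x)              ≡⟨ cong (rev (suc k)) (regroup q (2 ^ l) x) ⟩
  rev (suc k) (x + q * 2 ^ l * 2)              ≡⟨ rev-+*2 k x (q * 2 ^ l) ⟩
  x % 2 * 2 ^ k + rev k (x / 2 + q * 2 ^ l)    ≡⟨ cong (λ r → x % 2 * 2 ^ k + rev k r) (+-comm (x / 2) (q * 2 ^ l)) ⟩
  x % 2 * 2 ^ k + rev k (q * 2 ^ l + x / 2)    ≡⟨ cong (x % 2 * 2 ^ k +_) (rev-*2^+ l≤k q (x / 2) x/2<2^l) ⟩
  x % 2 * 2 ^ k + (R + P * rev l (x / 2))      ≡⟨ cong (λ p → x % 2 * p + (R + P * rev l (x / 2))) 2^k≡P*2^l ⟩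
  x % 2 * (P * 2 ^ l) + (R + P * rev l (x / 2)) ≡⟨ factor (x % 2) P (2 ^ l) R (rev l (x / 2)) ⟩
  R + P * (x % 2 * 2 ^ l + rev l (x / 2))      ∎
  where
  open ≡-Reasoning
  R = rev (k ∸ l) q
  P = 2 ^ (k ∸ l)
  regroup : ∀ q p x → q * (2 * p) + x ≡ x + q * p * 2
  regroup = solve 3 (λ q p x → q :* (con 2 :* p) :+ x := x :+ q :* p :* con 2) refl
  factor : ∀ b p m r s → b * (p * m) + (r + p * s) ≡ r + p * (b * m + s)
  factor = solve 5 (λ b p m r s → b :* (p :* m) :+ (r :+ p :* s) := r :+ p :* (b :* m :+ s)) refl
  x/2<2^l : x / 2 < 2 ^ l
  x/2<2^l = m<n*o⇒m/o<n (subst (x <_) (*-comm 2 (2 ^ l)) x<2^[1+l])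
  2^k≡P*2^l : 2 ^ k ≡ P * 2 ^ l
  2^k≡P*2^l = trans (cong (2 ^_) (sym (m∸n+n≡m l≤k))) (^-distribˡ-+-* 2 (k ∸ l) l)

rev-*2^ : ∀ {l k} → l ≤ k → ∀ q → rev k (q * 2 ^ l) ≡ rev (k ∸ l) q
rev-*2^ {l} {k} l≤k q = begin
  rev k (q * 2 ^ l)                          ≡⟨ cong (rev k) (+-identityʳ (q * 2 ^ l)) ⟨
  rev k (q * 2 ^ l + 0)                      ≡⟨ rev-*2^+ l≤k q 0 (m^n>0 2 l) ⟩
  rev (k ∸ l) q + 2 ^ (k ∸ l) * rev l 0      ≡⟨ cong (λ r → rev (k ∸ l) q + 2 ^ (k ∸ l) * r) (rev-zero l) ⟩
  rev (k ∸ l) q + 2 ^ (k ∸ l) * 0            ≡⟨ cong (rev (k ∸ l) q +_) (*-zeroʳ (2 ^ (k ∸ l))) ⟩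
  rev (k ∸ l) q + 0                          ≡⟨ +-identityʳ (rev (k ∸ l) q) ⟩
  rev (k ∸ l) q                              ∎
  where open ≡-Reasoning

[1+d]*2≤2*n : ∀ {d n} → d < n → suc d * 2 ≤ 2 * n
[1+d]*2≤2*n {d} {n} d<n = subst (suc d * 2 ≤_) (*-comm n 2) (*-monoˡ-≤ 2 d<n)

rev-surjective : ∀ l {x} → x < 2 ^ l → ∃ λ d → d < 2 ^ l × rev l d ≡ x
rev-surjective zero {zero} _ = 0 , s≤s z≤n , refl
rev-surjective zero {suc x} (s≤s ())
rev-surjective (suc l) {x} x<2^[1+l] with x <? 2 ^ l
... | yes x<2^l with rev-surjective l x<2^l
...   | d , d<2^l , rev-d≡x = d * 2 , ≤-trans (n≤1+n _) ([1+d]*2≤2*n d<2^l) , trans (rev-+*2 l 0 d) rev-d≡x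
rev-surjective (suc l) {x} x<2^[1+l] | no x≮2^l with rev-surjective l x∸2^l<2^l
  where
  x∸2^l<2^l : x ∸ 2 ^ l < 2 ^ l
  x∸2^l<2^l = m<n+o⇒m∸n<o x (2 ^ l) {{m^n≢0 2 l}} (subst (x <_) (cong (2 ^ l +_) (+-identityʳ (2 ^ l))) x<2^[1+l])
... | d , d<2^l , rev-d≡x∸2^l = 1 + d * 2 , [1+d]*2≤2*n d<2^l , (begin
  rev (suc l) (1 + d * 2)    ≡⟨ rev-+*2 l 1 d ⟩
  2 ^ l + 0 + rev l d        ≡⟨ cong₂ _+_ (+-identityʳ (2 ^ l)) rev-d≡x∸2^l ⟩
  2 ^ l + (x ∸ 2 ^ l)        ≡⟨ m+[n∸m]≡n (≮⇒≥ x≮2^l) ⟩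
  x                          ∎)
  where open ≡-Reasoning

dyadic-block : ∀ l {d} → d < 2 ^ l → ∃ λ j → j ≤ l × floorHalfPow j ≤ d × d < 2 ^ j
dyadic-block zero    {zero} _ = 0 , z≤n , z≤n , s≤s z≤n
dyadic-block zero    {suc d} (s≤s ())
dyadic-block (suc l) {d} d<2^[1+l] with d <? 2 ^ l
... | yes d<2^l with dyadic-block l d<2^l
...   | j , j≤l , lo , hi = j , m≤n⇒m≤1+n j≤l , lo , hi
dyadic-block (suc l) {d} d<2^[1+l] | no d≮2^l =
  suc l , ≤-refl , subst (_≤ d) 2^l≡2^[1+l]/2 (≮⇒≥ d≮2^l) , d<2^[1+l]
  where
  2^l≡2^[1+l]/2 : 2 ^ l ≡ floorHalfPow (suc l)
  2^l≡2^[1+l]/2 = sym (trans (cong (_/ 2) (*-comm 2 (2 ^ l))) (m*n/n≡m (2 ^ l) 2))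

blocks⇔interval : ∀ t l y →
  (∃ λ j → j ≤ l × (t + floorHalfPow j ≤ y) × (y ≤ t + 2 ^ j ∸ 1)) ⇔ (∃ λ d → d < 2 ^ l × y ≡ t + d)
blocks⇔interval t l y = mk⇔ to from
  where
  to : (∃ λ j → j ≤ l × (t + floorHalfPow j ≤ y) × (y ≤ t + 2 ^ j ∸ 1)) → ∃ λ d → d < 2 ^ l × y ≡ t + d
  to (j , j≤l , lo , hi) = y ∸ t , <-≤-trans y∸t<2^j (^-monoʳ-≤ 2 j≤l) , sym (m+[n∸m]≡n t≤y)
    where
    t≤y : t ≤ y
    t≤y = ≤-trans (m≤m+n t _) lo
    y<t+2^j : y < t + 2 ^ j
    y<t+2^j = m≤pred[n]⇒suc[m]≤n {{>-nonZero (≤-trans (m^n>0 2 j) (m≤n+m (2 ^ j) t))}} hi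
    y∸t<2^j : y ∸ t < 2 ^ j
    y∸t<2^j = m<n+o⇒m∸n<o y t {{m^n≢0 2 j}} y<t+2^j
  from : (∃ λ d → d < 2 ^ l × y ≡ t + d) → ∃ λ j → j ≤ l × (t + floorHalfPow j ≤ y) × (y ≤ t + 2 ^ j ∸ 1)
  from (d , d<2^l , refl) with dyadic-block l d<2^l
  ... | j , j≤l , lo , hi = j , j≤l , +-monoʳ-≤ t lo , <⇒≤pred (+-monoʳ-< t hi)

rev-blocks⇔progression : ∀ {l k t} → l ≤ k → 2 ^ l ∣ t → ∀ x →
  (∃ λ j → j ≤ l × ∃ λ y → ((t + floorHalfPow j ≤ y) × (y ≤ t + 2 ^ j ∸ 1)) × x ≡ rev k y)
  ⇔ (∃ λ x′ → x′ < 2 ^ l × x ≡ rev k t + 2 ^ (k ∸ l) * x′)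
rev-blocks⇔progression {l} {k} l≤k (divides-refl q) x = mk⇔ to from
  where
  t = q * 2 ^ l
  rev-split : ∀ d → d < 2 ^ l → rev k (t + d) ≡ rev k t + 2 ^ (k ∸ l) * rev l d
  rev-split d d<2^l = trans (rev-*2^+ l≤k q d d<2^l) (cong (_+ _) (sym (rev-*2^ l≤k q)))
  to : (∃ λ j → j ≤ l × ∃ λ y → ((t + floorHalfPow j ≤ y) × (y ≤ t + 2 ^ j ∸ 1)) × x ≡ rev k y) →
       ∃ λ x′ → x′ < 2 ^ l × x ≡ rev k t + 2 ^ (k ∸ l) * x′
  to (j , j≤l , y , (lo , hi) , refl) with Equivalence.to (blocks⇔interval t l y) (j , j≤l , lo , hi)
  ... | d , d<2^l , refl = rev l d , rev-< l d , rev-split d d<2^l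
  from : (∃ λ x′ → x′ < 2 ^ l × x ≡ rev k t + 2 ^ (k ∸ l) * x′) →
         ∃ λ j → j ≤ l × ∃ λ y → ((t + floorHalfPow j ≤ y) × (y ≤ t + 2 ^ j ∸ 1)) × x ≡ rev k y
  from (x′ , x′<2^l , refl) with rev-surjective l x′<2^l
  ... | d , d<2^l , refl with Equivalence.from (blocks⇔interval t l (t + d)) (d , d<2^l , refl)
  ... | j , j≤l , lo , hi = j , j≤l , t + d , (lo , hi) , sym (rev-split d d<2^l)

rev-multiple-< : ∀ {l k t} → l ≤ k → 2 ^ l ∣ t → rev k t < 2 ^ (k ∸ l)
rev-multiple-< {l} {k} l≤k (divides-refl q) = subst (_< 2 ^ (k ∸ l)) (sym (rev-*2^ l≤k q)) (rev-< (k ∸ l) q)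

lemma3 : (k s : ℕ) → s < 2 ^ k → (i L : ℕ) → IsLast k s L → i ≤ L →
    (l : ℕ) → l ≤ lseq k s i →
    ((x : ℕ) → (∃ λ j → (j ≤ l) × X k s i j x)
               ⇔ (∃ λ x′ → (x′ < 2 ^ l) × (x ≡ rev k (tseq k s i) + 2 ^ (k ∸ l) * x′)))
    × (rev k (tseq k s i) < 2 ^ (k ∸ l))
lemma3 k s _ i _ _ _ l l≤lᵢ = rev-blocks⇔progression l≤k 2^l∣t , rev-multiple-< l≤k 2^l∣t
  where
  t = tseq k s i
  l≤k : l ≤ k
  l≤k = ≤-trans l≤lᵢ (maxDivExp-≤ k t)
  2^l∣t : 2 ^ l ∣ t
  2^l∣t = ∣-trans (^-∣-^ 2 l≤lᵢ) (2^maxDivExp∣ k t)
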